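{- Let $\mathfrak{X}$ be an association scheme of rank $4$ with adjacency matrices $A_0=I,A_1,A_2,A_3$ of its constituents. Let $\eta$ be a non-trivial eigenvalue of $A_1$, i.e. $A_1v=\eta v$ for some nonzero vector $v$ orthogonal to the all-ones vector. Then $\eta^3+a_1\eta^2+a_2\eta+a_3=0$, where $$a_1=-(p^1_{1,1}+p^2_{1,2}-p^3_{1,1}-p^3_{1,2}),$$ $$a_2=(p^2_{1,2}-p^3_{1,2})(p^1_{1,1}-p^3_{1,1})-(p^2_{1,1}-p^3_{1,1})(p^1_{1,2}-p^3_{1,2})-(k_1-p^3_{1,1}),$$ $$a_3=(p^2_{1,2}-p^3_{1,2})(k_1-p^3_{1,1})+(p^2_{1,1}-p^3_{1,1})p^3_{1,2}.$$
   Context: An association scheme of rank $r$ on a finite vertex set $V$ is a surjective map $c:V\times V\to\{0,1,\dots,r-1\}$ such that $c(u,v)=0$ iff $u=v$, $c(u,v)=c(v,u)$, and for all colors $i,j,t$ there is an integer $p^t_{i,j}$ such that whenever $c(u,v)=t$ there are exactly $p^t_{i,j}$ vertices $w$ with $c(u,w)=i$, $c(w,v)=j$. The constituent $X_i$ is the graph on $V$ with distinct $u,v$ adjacent iff $c(u,v)=i$, with adjacency matrix $A_i$ ($A_0=I$); $X_i$ is regular of degree $k_i=p^0_{i,i}$. -}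

module Defs where

open import Level using (Level; _⊔_)
open import Data.Nat using (ℕ; zero; suc)
open import Data.Nat.Base as ℕ using ()
open import Data.Fin.Base as Fin using ()
open import Data.Fin using (Fin; zero; suc; _≟_; toℕ)
open import Data.List using (List; length; filter; allFin)
open import Data.Product using (Σ; ∃; ∃₂; _×_; _,_)
open import Relation.Nullary using (¬_; Dec; yes; no)
open import Relation.Nullary.Decidable using (_×-dec_)
open import Relation.Binary.PropositionalEquality using (_≡_)
open import Algebra.Bundles using (CommutativeRing)

countPaths : ∀ {n r} → (Fin n → Fin n → Fin r) →
             Fin n → Fin n → Fin r → Fin r → ℕ
countPaths {n} c u v i j =
  length (filter (λ w → (c u w ≟ i) ×-dec (c w v ≟ j)) (allFin n))

record AssociationScheme (n r : ℕ) : Set where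
  field
    col      : Fin n → Fin n → Fin r
    surj     : ∀ (t : Fin r) → ∃₂ λ u v → col u v ≡ t
    col0→eq  : ∀ u v → toℕ (col u v) ≡ 0 → u ≡ v
    eq→col0  : ∀ u → toℕ (col u u) ≡ 0
    col-sym  : ∀ u v → col u v ≡ col v u
    -- intersection numbers p t i j  =  p^t_{i,j}
    p        : Fin r → Fin r → Fin r → ℕ
    p-spec   : ∀ u v i j → countPaths col u v i j ≡ p (col u v) i j

record Field (c ℓ : Level) : Set (Level.suc (c ⊔ ℓ)) where
  field
    commRing : CommutativeRing c ℓ
  open CommutativeRing commRing public
  field
    1≉0     : ¬ (1# ≈ 0#)
    inverse : ∀ x → ¬ (x ≈ 0#) → ∃ λ y → x * y ≈ 1#

module FieldOps {c ℓ} (K : Field c ℓ) where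
  open Field K using (Carrier; _≈_; _+_; _*_; -_; _-_; 0#; 1#)

  ι : ℕ → Carrier
  ι ℕ.zero    = 0#
  ι (ℕ.suc m) = 1# + ι m

  ∑ : ∀ {m} → (Fin m → Carrier) → Carrier
  ∑ {ℕ.zero}  f = 0#
  ∑ {ℕ.suc m} f = f Fin.zero + ∑ (λ i → f (Fin.suc i))

  adj : ∀ {n r} → AssociationScheme n r → Fin r → Fin n → Fin n → Carrier
  adj X i u w with AssociationScheme.col X u w ≟ i
  ... | yes _ = 1#
  ... | no  _ = 0#

  _·_ : ∀ {n} → (Fin n → Fin n → Carrier) → (Fin n → Carrier) → Fin n → Carrier
  (M · v) u = ∑ (λ w → M u w * v w)

  𝟙 : ∀ {n} → Fin n → Carrier
  𝟙 _ = 1#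

  ⟨_,_⟩ : ∀ {n} → (Fin n → Carrier) → (Fin n → Carrier) → Carrier
  ⟨ v , w ⟩ = ∑ (λ u → v u * w u)

  NontrivialEigenvalue : ∀ {n r} → AssociationScheme n r → Fin r → Carrier → Set (c ⊔ ℓ)
  NontrivialEigenvalue {n} X i η =
    Σ (Fin n → Carrier) λ v →
      (∃ λ u → ¬ (v u ≈ 0#)) ×
      (⟨ v , 𝟙 ⟩ ≈ 0#) ×
      (∀ u → (adj X i · v) u ≈ η * v u)

  c0 c1 c2 c3 : Fin 4
  c0 = Fin.zero
  c1 = Fin.suc Fin.zero
  c2 = Fin.suc (Fin.suc Fin.zero)
  c3 = Fin.suc (Fin.suc (Fin.suc Fin.zero))

  module Coeffs {n : ℕ} (X : AssociationScheme n 4) where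
    P : Fin 4 → Fin 4 → Fin 4 → Carrier
    P t i j = ι (AssociationScheme.p X t i j)

    k₁ : Carrier
    k₁ = P c0 c1 c1

    a₁ : Carrier
    a₁ = - (P c1 c1 c1 + P c2 c1 c2 - P c3 c1 c1 - P c3 c1 c2)

    a₂ : Carrier
    a₂ = (P c2 c1 c2 - P c3 c1 c2) * (P c1 c1 c1 - P c3 c1 c1)
         - (P c2 c1 c1 - P c3 c1 c1) * (P c1 c1 c2 - P c3 c1 c2)
         - (k₁ - P c3 c1 c1)

    a₃ : Carrier
    a₃ = (P c2 c1 c2 - P c3 c1 c2) * (k₁ - P c3 c1 c1)
         + (P c2 c1 c1 - P c3 c1 c1) * P c3 c1 c2

-- Write y = A₂v and z = A₃v for the eigenvector v.  Since A₀ + A₁ + A₂ + A₃ is the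
-- all-ones matrix and v ⊥ 𝟙, v + ηv + y + z = 0.  Expanding
-- A₁² = k₁I + p¹₁₁A₁ + p²₁₁A₂ + p³₁₁A₃ on v and eliminating z gives
-- (p²₁₁ − p³₁₁)·y = q(η)·v with q quadratic.  Applying A₁ and expanding
-- A₁A₂ = p¹₁₂A₁ + p²₁₂A₂ + p³₁₂A₃ (p⁰₁₂ = 0) eliminates y as well, leaving
-- (cubic in η)·v = 0; a coordinate where v does not vanish gives the claim.
module Submission where

open import Algebra.Bundles using (CommutativeRing)
import Algebra.Solver.Ring
open import Algebra.Solver.Ring.AlmostCommutativeRing
  using (_-Raw-AlmostCommutative⟶_; fromCommutativeRing)
open import Data.Bool.Base using (if_then_else_)
open import Data.Fin.Base using (Fin; zero; suc; toℕ; punchIn)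
open import Data.Fin.Properties using (_≟_; punchInᵢ≢i; toℕ-injective)
open import Data.List.Base using (length; filter; tabulate)
open import Data.List.Properties using (filter-none)
open import Data.List.Relation.Unary.All.Properties using (tabulate⁺)
open import Data.Maybe.Base as Maybe using (Maybe)
open import Data.Nat.Base as ℕ using (ℕ; zero; suc)
import Data.Nat.Properties as ℕ
open import Data.Product.Base using (_,_)
open import Data.Sign.Base as Sign using (Sign)
open import Data.Vec.Functional using (removeAt; replicate)
open import Function.Base using (_∘_; id)
open import Relation.Binary.Consequences using (dec⇒weaklyDec)
open import Relation.Binary.PropositionalEquality as ≡ using (_≡_; _≢_; cong; cong₂)
open import Relation.Nullary using (¬_; Dec; yes; no; does)
open import Relation.Nullary.Decidable using (_×-dec_; dec-true; dec-false)

open import Defs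

-- Algebra.Solver.Ring normalises with coefficients of decidable equality; ℤ maps into every
-- commutative ring.
module IntegerCoefficients {c ℓ} (R : CommutativeRing c ℓ) where
  open CommutativeRing R
  open import Data.Integer.Base as ℤ using (ℤ; +_; -[1+_]; _⊖_; _◃_; sign; ∣_∣)
  import Data.Integer.Properties as ℤ
  open import Algebra.Properties.Ring ring
  open import Algebra.Properties.Semiring.Mult semiring using (_×_; ×-homo-+; ×1-homo-*)
  open import Algebra.Properties.CommutativeSemigroup *-commutativeSemigroup
    using () renaming (interchange to *-interchange)
  open import Algebra.Properties.CommutativeSemigroup +-commutativeSemigroup
    using () renaming (interchange to +-interchange)
  open import Relation.Binary.Reasoning.Setoid setoid

  fromℤ : ℤ → Carrier
  fromℤ (+ m)    = m × 1#
  fromℤ -[1+ m ] = - (suc m × 1#)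

  fromSign : Sign → Carrier
  fromSign Sign.+ = 1#
  fromSign Sign.- = - 1#

  [1+x]-[1+y]≈x-y : ∀ x y → (1# + x) - (1# + y) ≈ x - y
  [1+x]-[1+y]≈x-y x y = begin
    (1# + x) + - (1# + y)   ≈⟨ +-congˡ (-‿+-comm 1# y) ⟨
    (1# + x) + (- 1# + - y) ≈⟨ +-interchange 1# x (- 1#) (- y) ⟩
    (1# + - 1#) + (x + - y) ≈⟨ +-congʳ (-‿inverseʳ 1#) ⟩
    0# + (x - y)            ≈⟨ +-identityˡ (x - y) ⟩
    x - y                   ∎

  fromℤ-⊖ : ∀ m n → fromℤ (m ⊖ n) ≈ m × 1# - n × 1#
  fromℤ-⊖ zero    zero    = sym (-‿inverseʳ 0#)
  fromℤ-⊖ zero    (suc n) = sym (+-identityˡ _)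
  fromℤ-⊖ (suc m) zero    = sym (trans (+-congˡ -0#≈0#) (+-identityʳ _))
  fromℤ-⊖ (suc m) (suc n) = begin
    fromℤ (suc m ⊖ suc n)       ≡⟨ cong fromℤ (ℤ.[1+m]⊖[1+n]≡m⊖n m n) ⟩
    fromℤ (m ⊖ n)               ≈⟨ fromℤ-⊖ m n ⟩
    m × 1# - n × 1#             ≈⟨ [1+x]-[1+y]≈x-y _ _ ⟨
    suc m × 1# - suc n × 1#     ∎

  fromℤ-+ : ∀ i j → fromℤ (i ℤ.+ j) ≈ fromℤ i + fromℤ j
  fromℤ-+ (+ m)    (+ n)    = ×-homo-+ 1# m n
  fromℤ-+ (+ m)    -[1+ n ] = fromℤ-⊖ m (suc n)
  fromℤ-+ -[1+ m ] (+ n)    = trans (fromℤ-⊖ n (suc m)) (+-comm _ _)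
  fromℤ-+ -[1+ m ] -[1+ n ] = begin
    - (suc (suc (m ℕ.+ n)) × 1#)       ≡⟨ cong (λ k → - (suc k × 1#)) (ℕ.+-suc m n) ⟨
    - ((suc m ℕ.+ suc n) × 1#)         ≈⟨ -‿cong (×-homo-+ 1# (suc m) (suc n)) ⟩
    - (suc m × 1# + suc n × 1#)        ≈⟨ -‿+-comm _ _ ⟨
    - (suc m × 1#) + - (suc n × 1#)    ∎

  fromℤ-neg : ∀ i → fromℤ (ℤ.- i) ≈ - fromℤ i
  fromℤ-neg (+ zero)  = sym -0#≈0#
  fromℤ-neg (+ suc m) = refl
  fromℤ-neg -[1+ m ]  = sym (-‿involutive _)

  fromℤ-◃ : ∀ s n → fromℤ (s ◃ n) ≈ fromSign s * n × 1#
  fromℤ-◃ s      zero    = sym (zeroʳ _)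
  fromℤ-◃ Sign.+ (suc n) = sym (*-identityˡ _)
  fromℤ-◃ Sign.- (suc n) = sym (-1*x≈-x _)

  fromSign-* : ∀ s t → fromSign (s Sign.* t) ≈ fromSign s * fromSign t
  fromSign-* Sign.+ t      = sym (*-identityˡ _)
  fromSign-* Sign.- Sign.+ = sym (*-identityʳ _)
  fromSign-* Sign.- Sign.- = sym (trans (-1*x≈-x _) (-‿involutive 1#))

  fromℤ-* : ∀ i j → fromℤ (i ℤ.* j) ≈ fromℤ i * fromℤ j
  fromℤ-* i j = begin
    fromℤ (sign i Sign.* sign j ◃ ∣ i ∣ ℕ.* ∣ j ∣)
      ≈⟨ fromℤ-◃ (sign i Sign.* sign j) (∣ i ∣ ℕ.* ∣ j ∣) ⟩
    fromSign (sign i Sign.* sign j) * (∣ i ∣ ℕ.* ∣ j ∣) × 1#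
      ≈⟨ *-cong (fromSign-* (sign i) (sign j)) (×1-homo-* ∣ i ∣ ∣ j ∣) ⟩
    (fromSign (sign i) * fromSign (sign j)) * (∣ i ∣ × 1# * ∣ j ∣ × 1#)
      ≈⟨ *-interchange _ _ _ _ ⟩
    (fromSign (sign i) * ∣ i ∣ × 1#) * (fromSign (sign j) * ∣ j ∣ × 1#)
      ≈⟨ *-cong (fromℤ-◃ (sign i) ∣ i ∣) (fromℤ-◃ (sign j) ∣ j ∣) ⟨
    fromℤ (sign i ◃ ∣ i ∣) * fromℤ (sign j ◃ ∣ j ∣)
      ≡⟨ cong₂ (λ i′ j′ → fromℤ i′ * fromℤ j′) (ℤ.◃-inverse i) (ℤ.◃-inverse j) ⟩
    fromℤ i * fromℤ j
      ∎

  fromℤ-homomorphism : ℤ.+-*-rawRing -Raw-AlmostCommutative⟶ fromCommutativeRing R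
  fromℤ-homomorphism = record
    { ⟦_⟧    = fromℤ
    ; +-homo = fromℤ-+
    ; *-homo = fromℤ-*
    ; -‿homo = fromℤ-neg
    ; 0-homo = refl
    ; 1-homo = +-identityʳ 1#
    }

  fromℤ-≟ : ∀ i j → Maybe (fromℤ i ≈ fromℤ j)
  fromℤ-≟ i j = Maybe.map (λ i≡j → reflexive (cong fromℤ i≡j)) (dec⇒weaklyDec ℤ._≟_ i j)

  open Algebra.Solver.Ring ℤ.+-*-rawRing (fromCommutativeRing R) fromℤ-homomorphism fromℤ-≟ public
    using (solve; _:=_; _:+_; _:*_; :-_; _:-_; con)

module MatrixAlgebra {c ℓ} (K : Field c ℓ) where
  open Field K hiding (zero)
  open FieldOps K
  open import Algebra.Properties.Semiring.Sum semiring
    using (sum; sum-cong-≋; sum-remove; sum-replicate-zero; ∑-comm; *-distribˡ-sum; *-distribʳ-sum)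
  open import Algebra.Properties.CommutativeSemigroup *-commutativeSemigroup using (x∙yz≈y∙xz)
  open import Relation.Binary.Reasoning.Setoid setoid

  ∑≡sum : ∀ {m} (f : Fin m → Carrier) → ∑ f ≡ sum f
  ∑≡sum {zero}  f = ≡.refl
  ∑≡sum {suc m} f = cong (f zero +_) (∑≡sum (λ i → f (suc i)))

  sum-δ : ∀ {m} (f : Fin m → Carrier) i → (∀ j → j ≢ i → f j ≈ 0#) → sum f ≈ f i
  sum-δ {suc m} f i f≈0 = begin
    sum f                       ≈⟨ sum-remove f ⟩
    f i + sum (removeAt f i)    ≈⟨ +-congˡ (sum-cong-≋ (λ j → f≈0 (punchIn i j) (punchInᵢ≢i i j))) ⟩
    f i + sum (replicate m 0#)  ≈⟨ +-congˡ (sum-replicate-zero m) ⟩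
    f i + 0#                    ≈⟨ +-identityʳ (f i) ⟩
    f i                         ∎

  indicator : ∀ {a} {A : Set a} → Dec A → Carrier
  indicator a? = if does a? then 1# else 0#

  indicator-true : ∀ {a} {A : Set a} (a? : Dec A) → A → indicator a? ≡ 1#
  indicator-true a? a rewrite dec-true a? a = ≡.refl

  indicator-false : ∀ {a} {A : Set a} (a? : Dec A) → ¬ A → indicator a? ≡ 0#
  indicator-false a? ¬a rewrite dec-false a? ¬a = ≡.refl

  indicator-×-dec : ∀ {a b} {A : Set a} {B : Set b} (a? : Dec A) (b? : Dec B) →
                    indicator (a? ×-dec b?) ≈ indicator a? * indicator b?
  indicator-×-dec (yes _) (yes _) = sym (*-identityˡ 1#)
  indicator-×-dec (yes _) (no _)  = sym (*-identityˡ 0#)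
  indicator-×-dec (no _)  b?      = sym (zeroˡ (indicator b?))

  ι-length-filter : ∀ {A : Set} {P : A → Set} (P? : ∀ x → Dec (P x)) {m} (f : Fin m → A) →
                    ι (length (filter P? (tabulate f))) ≈ sum (λ i → indicator (P? (f i)))
  ι-length-filter P? {zero}  f = refl
  ι-length-filter P? {suc m} f with P? (f zero)
  ... | yes _ = +-congˡ (ι-length-filter P? (λ i → f (suc i)))
  ... | no  _ = trans (ι-length-filter P? (λ i → f (suc i))) (sym (+-identityˡ _))

  sum-indicator : ∀ {m} (t : Fin m) (F : Fin m → Carrier) →
                  sum (λ s → F s * indicator (t ≟ s)) ≈ F t
  sum-indicator t F = begin
    sum (λ s → F s * indicator (t ≟ s))  ≈⟨ sum-δ _ t off-t ⟩
    F t * indicator (t ≟ t)              ≡⟨ cong (F t *_) (indicator-true (t ≟ t) ≡.refl) ⟩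
    F t * 1#                             ≈⟨ *-identityʳ (F t) ⟩
    F t                                  ∎
    where
    off-t : ∀ s → s ≢ t → F s * indicator (t ≟ s) ≈ 0#
    off-t s s≢t = begin
      F s * indicator (t ≟ s)  ≡⟨ cong (F s *_) (indicator-false (t ≟ s) (s≢t ∘ ≡.sym)) ⟩
      F s * 0#                 ≈⟨ zeroʳ (F s) ⟩
      0#                       ∎

  Matrix : ℕ → Set c
  Matrix n = Fin n → Fin n → Carrier

  _⊙_ : ∀ {n} → Matrix n → Matrix n → Matrix n
  (M ⊙ N) u x = sum (λ w → M u w * N w x)

  module _ {n : ℕ} where

    ·≡sum : ∀ (M : Matrix n) v u → (M · v) u ≡ sum (λ w → M u w * v w)
    ·≡sum M v u = ∑≡sum (λ w → M u w * v w)

    ·-cong-terms : ∀ (M N : Matrix n) {v w} u →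
                   (∀ x → M u x * v x ≈ N u x * w x) → (M · v) u ≈ (N · w) u
    ·-cong-terms M N {v} {w} u terms≈ = begin
      (M · v) u                 ≡⟨ ·≡sum M v u ⟩
      sum (λ x → M u x * v x)   ≈⟨ sum-cong-≋ terms≈ ⟩
      sum (λ x → N u x * w x)   ≡⟨ ·≡sum N w u ⟨
      (N · w) u                 ∎

    ·-congʳ : ∀ (M : Matrix n) {v w} → (∀ x → v x ≈ w x) → ∀ u → (M · v) u ≈ (M · w) u
    ·-congʳ M v≈w u = ·-cong-terms M M u (λ x → *-congˡ (v≈w x))

    ·-scalar : ∀ (M : Matrix n) a v u → (M · (λ x → a * v x)) u ≈ a * (M · v) u
    ·-scalar M a v u = begin
      (M · (λ x → a * v x)) u        ≡⟨ ·≡sum M (λ x → a * v x) u ⟩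
      sum (λ x → M u x * (a * v x))  ≈⟨ sum-cong-≋ (λ x → x∙yz≈y∙xz (M u x) a (v x)) ⟩
      sum (λ x → a * (M u x * v x))  ≈⟨ *-distribˡ-sum a (λ x → M u x * v x) ⟨
      a * sum (λ x → M u x * v x)    ≡⟨ cong (a *_) (·≡sum M v u) ⟨
      a * (M · v) u                  ∎

    ·-assoc : ∀ (M N : Matrix n) v u → (M · (N · v)) u ≈ ((M ⊙ N) · v) u
    ·-assoc M N v u = begin
      (M · (N · v)) u
        ≈⟨ ·-cong-terms M M u (λ w → *-congˡ (reflexive (·≡sum N v w))) ⟩
      (M · (λ w → sum (λ x → N w x * v x))) u
        ≡⟨ ·≡sum M (λ w → sum (λ x → N w x * v x)) u ⟩
      sum (λ w → M u w * sum (λ x → N w x * v x))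
        ≈⟨ sum-cong-≋ (λ w → *-distribˡ-sum (M u w) (λ x → N w x * v x)) ⟩
      sum (λ w → sum (λ x → M u w * (N w x * v x)))
        ≈⟨ ∑-comm (λ w x → M u w * (N w x * v x)) ⟩
      sum (λ x → sum (λ w → M u w * (N w x * v x)))
        ≈⟨ sum-cong-≋ (λ x → sum-cong-≋ (λ w → *-assoc (M u w) (N w x) (v x))) ⟨
      sum (λ x → sum (λ w → (M u w * N w x) * v x))
        ≈⟨ sum-cong-≋ (λ x → *-distribʳ-sum (v x) (λ w → M u w * N w x)) ⟨
      sum (λ x → (M ⊙ N) u x * v x)
        ≡⟨ ·≡sum (M ⊙ N) v u ⟨
      ((M ⊙ N) · v) u
        ∎

    ·-linear-combination : ∀ {r} (a : Fin r → Carrier) (B : Fin r → Matrix n) v u →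
      ((λ u x → sum (λ t → a t * B t u x)) · v) u ≈ sum (λ t → a t * (B t · v) u)
    ·-linear-combination a B v u = begin
      (A · v) u
        ≡⟨ ·≡sum A v u ⟩
      sum (λ x → sum (λ t → a t * B t u x) * v x)
        ≈⟨ sum-cong-≋ (λ x → *-distribʳ-sum (v x) (λ t → a t * B t u x)) ⟩
      sum (λ x → sum (λ t → (a t * B t u x) * v x))
        ≈⟨ ∑-comm (λ x t → (a t * B t u x) * v x) ⟩
      sum (λ t → sum (λ x → (a t * B t u x) * v x))
        ≈⟨ sum-cong-≋ (λ t → sum-cong-≋ (λ x → *-assoc (a t) (B t u x) (v x))) ⟩
      sum (λ t → sum (λ x → a t * (B t u x * v x)))
        ≈⟨ sum-cong-≋ (λ t → *-distribˡ-sum (a t) (λ x → B t u x * v x)) ⟨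
      sum (λ t → a t * sum (λ x → B t u x * v x))
        ≈⟨ sum-cong-≋ (λ t → *-congˡ (reflexive (·≡sum (B t) v u))) ⟨
      sum (λ t → a t * (B t · v) u)
        ∎
      where
      A : Matrix n
      A u x = sum (λ t → a t * B t u x)

module SchemeAlgebra {c ℓ} (K : Field c ℓ) where
  open Field K hiding (zero)
  open FieldOps K
  open MatrixAlgebra K
  open import Data.Product.Base using (_×_)
  open import Algebra.Properties.Semiring.Sum semiring using (sum; sum-cong-≋; sum-cong-≗)
  open import Relation.Binary.Reasoning.Setoid setoid

  module _ {n r : ℕ} (X : AssociationScheme n r) where
    open AssociationScheme X

    adj≡indicator : ∀ i u w → adj X i u w ≡ indicator (col u w ≟ i)
    adj≡indicator i u w with col u w ≟ i
    ... | yes _ = ≡.refl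
    ... | no  _ = ≡.refl

    adj-⊙-adj : ∀ i j u x → (adj X i ⊙ adj X j) u x ≈ ι (p (col u x) i j)
    adj-⊙-adj i j u x = begin
      sum (λ w → adj X i u w * adj X j w x)                 ≈⟨ sum-cong-≋ adj*adj≈indicator ⟩
      sum (λ w → indicator (path? w))                       ≈⟨ ι-length-filter path? id ⟨
      ι (countPaths col u x i j)                            ≡⟨ cong ι (p-spec u x i j) ⟩
      ι (p (col u x) i j)                                   ∎
      where
      path? : ∀ w → Dec (col u w ≡ i × col w x ≡ j)
      path? w = (col u w ≟ i) ×-dec (col w x ≟ j)

      adj*adj≈indicator : ∀ w → adj X i u w * adj X j w x ≈ indicator (path? w)
      adj*adj≈indicator w = begin
        adj X i u w * adj X j w x
          ≡⟨ cong₂ _*_ (adj≡indicator i u w) (adj≡indicator j w x) ⟩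
        indicator (col u w ≟ i) * indicator (col w x ≟ j)
          ≈⟨ indicator-×-dec (col u w ≟ i) (col w x ≟ j) ⟨
        indicator (path? w)
          ∎

    adj-·-adj : ∀ i j v u →
                (adj X i · (adj X j · v)) u ≈ sum (λ t → ι (p t i j) * (adj X t · v) u)
    adj-·-adj i j v u = begin
      (adj X i · (adj X j · v)) u    ≈⟨ ·-assoc (adj X i) (adj X j) v u ⟩
      ((adj X i ⊙ adj X j) · v) u    ≈⟨ ·-cong-terms (adj X i ⊙ adj X j) A u (λ x → *-congʳ (entries x)) ⟩
      (A · v) u                      ≈⟨ ·-linear-combination (λ t → ι (p t i j)) (adj X) v u ⟩
      sum (λ t → ι (p t i j) * (adj X t · v) u) ∎
      where
      A : Matrix n
      A u x = sum (λ t → ι (p t i j) * adj X t u x)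

      entries : ∀ x → (adj X i ⊙ adj X j) u x ≈ A u x
      entries x = begin
        (adj X i ⊙ adj X j) u x
          ≈⟨ adj-⊙-adj i j u x ⟩
        ι (p (col u x) i j)
          ≈⟨ sum-indicator (col u x) (λ t → ι (p t i j)) ⟨
        sum (λ t → ι (p t i j) * indicator (col u x ≟ t))
          ≡⟨ sum-cong-≗ (λ t → cong (ι (p t i j) *_) (adj≡indicator t u x)) ⟨
        A u x
          ∎

    sum-adj-· : ∀ v u → sum (λ t → (adj X t · v) u) ≈ ⟨ v , 𝟙 ⟩
    sum-adj-· v u = begin
      sum (λ t → (adj X t · v) u)       ≈⟨ sum-cong-≋ (λ t → *-identityˡ ((adj X t · v) u)) ⟨
      sum (λ t → 1# * (adj X t · v) u)  ≈⟨ ·-linear-combination (λ _ → 1#) (adj X) v u ⟨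
      (J · v) u                         ≈⟨ ·-cong-terms J (λ _ x → v x) u J-terms ⟩
      ⟨ v , 𝟙 ⟩                         ∎
      where
      J : Matrix n
      J u x = sum (λ t → 1# * adj X t u x)

      J-terms : ∀ x → J u x * v x ≈ v x * 1#
      J-terms x = begin
        J u x * v x
          ≡⟨ cong (_* v x) (sum-cong-≗ (λ t → cong (1# *_) (adj≡indicator t u x))) ⟩
        sum (λ t → 1# * indicator (col u x ≟ t)) * v x
          ≈⟨ *-congʳ (sum-indicator (col u x) (λ _ → 1#)) ⟩
        1# * v x
          ≈⟨ *-comm 1# (v x) ⟩
        v x * 1#
          ∎

  module _ {n r : ℕ} (X : AssociationScheme n (suc r)) where
    open AssociationScheme X

    col-diagonal : ∀ u → col u u ≡ zero
    col-diagonal u = toℕ-injective (eq→col0 u)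

    adj-zero-diagonal : ∀ u → adj X zero u u ≡ 1#
    adj-zero-diagonal u =
      ≡.trans (adj≡indicator X zero u u) (indicator-true (col u u ≟ zero) (col-diagonal u))

    adj-zero-off-diagonal : ∀ {u x} → x ≢ u → adj X zero u x ≡ 0#
    adj-zero-off-diagonal {u} {x} x≢u =
      ≡.trans (adj≡indicator X zero u x) (indicator-false (col u x ≟ zero) col≢zero)
      where
      col≢zero : col u x ≢ zero
      col≢zero col≡zero = x≢u (≡.sym (col0→eq u x (cong toℕ col≡zero)))

    adj-zero-· : ∀ v u → (adj X zero · v) u ≈ v u
    adj-zero-· v u = begin
      (adj X zero · v) u                ≡⟨ ·≡sum (adj X zero) v u ⟩
      sum (λ x → adj X zero u x * v x)  ≈⟨ sum-δ _ u off-diagonal ⟩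
      adj X zero u u * v u              ≡⟨ cong (_* v u) (adj-zero-diagonal u) ⟩
      1# * v u                          ≈⟨ *-identityˡ (v u) ⟩
      v u                               ∎
      where
      off-diagonal : ∀ x → x ≢ u → adj X zero u x * v x ≈ 0#
      off-diagonal x x≢u = trans (*-congʳ (reflexive (adj-zero-off-diagonal x≢u))) (zeroˡ (v x))

    -- The vertex is needed: without vertices the intersection numbers are unconstrained.
    p-zero-≢ : Fin n → ∀ {i j} → i ≢ j → p zero i j ≡ 0
    p-zero-≢ u {i} {j} i≢j =
      ≡.trans (cong (λ t → p t i j) (≡.sym (col-diagonal u)))
        (≡.trans (≡.sym (p-spec u u i j))
          (cong length (filter-none path? (tabulate⁺ no-path))))
      where
      path? : ∀ w → Dec (col u w ≡ i × col w u ≡ j)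
      path? w = (col u w ≟ i) ×-dec (col w u ≟ j)

      no-path : ∀ w → ¬ (col u w ≡ i × col w u ≡ j)
      no-path w (col≡i , col≡j) = i≢j (≡.trans (≡.sym col≡i) (≡.trans (col-sym u w) col≡j))

module CubicElimination {c ℓ} (R : CommutativeRing c ℓ) where
  open CommutativeRing R
  open IntegerCoefficients R
  open import Data.Integer.Base using (+_)
  open import Algebra.Properties.Ring ring using (x∙y⁻¹≈ε⇒x≈y; x≈y⇒x∙y⁻¹≈ε)
  open import Relation.Binary.Reasoning.Setoid setoid

  -- The trailing 0#s are those of sums over Fin 4, which unfold to right-nested sums.
  quadratic-relation : ∀ {η v y z k p¹ p² p³} →
    η * (η * v) ≈ k * v + (p¹ * (η * v) + (p² * y + (p³ * z + 0#))) →
    v + (η * v + (y + (z + 0#))) ≈ 0# →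
    (p² - p³) * y ≈ (η * η - (p¹ - p³) * η - (k - p³)) * v
  quadratic-relation {η} {v} {y} {z} {k} {p¹} {p²} {p³} square sum≈0 =
    x∙y⁻¹≈ε⇒x≈y _ _ (begin
    (p² - p³) * y - (η * η - (p¹ - p³) * η - (k - p³)) * v
      ≈⟨ identity η v y z k p¹ p² p³ ⟩
    (k * v + (p¹ * (η * v) + (p² * y + (p³ * z + 0#)))) - η * (η * v)
      + (- p³) * (v + (η * v + (y + (z + 0#))))
      ≈⟨ +-cong (x≈y⇒x∙y⁻¹≈ε (sym square)) (*-congˡ sum≈0) ⟩
    0# + (- p³) * 0#
      ≈⟨ trans (+-identityˡ _) (zeroʳ (- p³)) ⟩
    0# ∎)
    where
    identity : ∀ η v y z k p¹ p² p³ →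
      (p² - p³) * y - (η * η - (p¹ - p³) * η - (k - p³)) * v
        ≈ (k * v + (p¹ * (η * v) + (p² * y + (p³ * z + 0#)))) - η * (η * v)
          + (- p³) * (v + (η * v + (y + (z + 0#))))
    identity = solve 8 (λ η v y z k p¹ p² p³ →
      (p² :- p³) :* y :- (η :* η :- (p¹ :- p³) :* η :- (k :- p³)) :* v
        := (k :* v :+ (p¹ :* (η :* v) :+ (p² :* y :+ (p³ :* z :+ con (+ 0))))) :- η :* (η :* v)
           :+ (:- p³) :* (v :+ (η :* v :+ (y :+ (z :+ con (+ 0)))))) refl

  cubic-relation : ∀ {η v y z w k p¹₁₁ p²₁₁ p³₁₁ p¹₁₂ p²₁₂ p³₁₂} →
    let α = p²₁₁ - p³₁₁
        q = η * η - (p¹₁₁ - p³₁₁) * η - (k - p³₁₁)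
    in α * y ≈ q * v →
       α * w ≈ q * (η * v) →
       w ≈ p¹₁₂ * (η * v) + (p²₁₂ * y + (p³₁₂ * z + 0#)) →
       v + (η * v + (y + (z + 0#))) ≈ 0# →
       (η * η * η + (- (p¹₁₁ + p²₁₂ - p³₁₁ - p³₁₂)) * η * η
         + ((p²₁₂ - p³₁₂) * (p¹₁₁ - p³₁₁) - (p²₁₁ - p³₁₁) * (p¹₁₂ - p³₁₂) - (k - p³₁₁)) * η
         + ((p²₁₂ - p³₁₂) * (k - p³₁₁) + (p²₁₁ - p³₁₁) * p³₁₂)) * v ≈ 0#
  cubic-relation {η} {v} {y} {z} {w} {k} {p¹₁₁} {p²₁₁} {p³₁₁} {p¹₁₂} {p²₁₂} {p³₁₂}
                 quadratic applied product sum≈0 = begin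
    _ ≈⟨ identity η v y z w k p¹₁₁ p²₁₁ p³₁₁ p¹₁₂ p²₁₂ p³₁₂ ⟩
    - (α * w - q * (η * v)) + α * (w - (p¹₁₂ * (η * v) + (p²₁₂ * y + (p³₁₂ * z + 0#))))
      + (α * p³₁₂) * (v + (η * v + (y + (z + 0#)))) + (p²₁₂ - p³₁₂) * (α * y - q * v)
      ≈⟨ +-cong (+-cong (+-cong (-‿cong (x≈y⇒x∙y⁻¹≈ε applied)) (*-congˡ (x≈y⇒x∙y⁻¹≈ε product)))
                        (*-congˡ sum≈0))
                (*-congˡ (x≈y⇒x∙y⁻¹≈ε quadratic)) ⟩
    - 0# + α * 0# + (α * p³₁₂) * 0# + (p²₁₂ - p³₁₂) * 0#
      ≈⟨ zeros α (α * p³₁₂) (p²₁₂ - p³₁₂) ⟩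
    0# ∎
    where
    α = p²₁₁ - p³₁₁
    q = η * η - (p¹₁₁ - p³₁₁) * η - (k - p³₁₁)

    zeros : ∀ a b c → - 0# + a * 0# + b * 0# + c * 0# ≈ 0#
    zeros = solve 3 (λ a b c →
      :- con (+ 0) :+ a :* con (+ 0) :+ b :* con (+ 0) :+ c :* con (+ 0) := con (+ 0)) refl

    identity : ∀ η v y z w k p¹₁₁ p²₁₁ p³₁₁ p¹₁₂ p²₁₂ p³₁₂ →
      (η * η * η + (- (p¹₁₁ + p²₁₂ - p³₁₁ - p³₁₂)) * η * η
        + ((p²₁₂ - p³₁₂) * (p¹₁₁ - p³₁₁) - (p²₁₁ - p³₁₁) * (p¹₁₂ - p³₁₂) - (k - p³₁₁)) * η
        + ((p²₁₂ - p³₁₂) * (k - p³₁₁) + (p²₁₁ - p³₁₁) * p³₁₂)) * v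
        ≈ - ((p²₁₁ - p³₁₁) * w - (η * η - (p¹₁₁ - p³₁₁) * η - (k - p³₁₁)) * (η * v))
          + (p²₁₁ - p³₁₁) * (w - (p¹₁₂ * (η * v) + (p²₁₂ * y + (p³₁₂ * z + 0#))))
          + ((p²₁₁ - p³₁₁) * p³₁₂) * (v + (η * v + (y + (z + 0#))))
          + (p²₁₂ - p³₁₂) * ((p²₁₁ - p³₁₁) * y - (η * η - (p¹₁₁ - p³₁₁) * η - (k - p³₁₁)) * v)
    identity = solve 12 (λ η v y z w k p¹₁₁ p²₁₁ p³₁₁ p¹₁₂ p²₁₂ p³₁₂ →
      (η :* η :* η :+ (:- (p¹₁₁ :+ p²₁₂ :- p³₁₁ :- p³₁₂)) :* η :* η
        :+ ((p²₁₂ :- p³₁₂) :* (p¹₁₁ :- p³₁₁) :- (p²₁₁ :- p³₁₁) :* (p¹₁₂ :- p³₁₂) :- (k :- p³₁₁)) :* η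
        :+ ((p²₁₂ :- p³₁₂) :* (k :- p³₁₁) :+ (p²₁₁ :- p³₁₁) :* p³₁₂)) :* v
        := :- ((p²₁₁ :- p³₁₁) :* w :- (η :* η :- (p¹₁₁ :- p³₁₁) :* η :- (k :- p³₁₁)) :* (η :* v))
           :+ (p²₁₁ :- p³₁₁) :* (w :- (p¹₁₂ :* (η :* v) :+ (p²₁₂ :* y :+ (p³₁₂ :* z :+ con (+ 0)))))
           :+ ((p²₁₁ :- p³₁₁) :* p³₁₂) :* (v :+ (η :* v :+ (y :+ (z :+ con (+ 0)))))
           :+ (p²₁₂ :- p³₁₂) :* ((p²₁₁ :- p³₁₁) :* y :- (η :* η :- (p¹₁₁ :- p³₁₁) :* η :- (k :- p³₁₁)) :* v)) refl

module _ {c ℓ} (K : Field c ℓ) where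
  open Field K hiding (zero)
  open import Relation.Binary.Reasoning.Setoid setoid

  x*y≈0⇒y≉0⇒x≈0 : ∀ {x y} → x * y ≈ 0# → ¬ y ≈ 0# → x ≈ 0#
  x*y≈0⇒y≉0⇒x≈0 {x} {y} x*y≈0 y≉0 with inverse y y≉0
  ... | y⁻¹ , y*y⁻¹≈1 = begin
    x              ≈⟨ *-identityʳ x ⟨
    x * 1#         ≈⟨ *-congˡ y*y⁻¹≈1 ⟨
    x * (y * y⁻¹)  ≈⟨ *-assoc x y y⁻¹ ⟨
    (x * y) * y⁻¹  ≈⟨ *-congʳ x*y≈0 ⟩
    0# * y⁻¹       ≈⟨ zeroˡ y⁻¹ ⟩
    0#             ∎

module RankFour {c ℓ} (K : Field c ℓ) {n : ℕ} (X : AssociationScheme n 4) where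
  open Field K hiding (zero)
  open FieldOps K
  open Coeffs X
  open MatrixAlgebra K
  open SchemeAlgebra K
  open CubicElimination commRing
  open import Algebra.Properties.Semiring.Sum semiring using (sum)
  open import Relation.Binary.Reasoning.Setoid setoid

  module _ {η : Carrier} (v : Fin n → Carrier)
           (eigen : ∀ u → (adj X c1 · v) u ≈ η * v u) (v⊥𝟙 : ⟨ v , 𝟙 ⟩ ≈ 0#) where

    y z : Fin n → Carrier
    y = adj X c2 · v
    z = adj X c3 · v

    α q : Carrier
    α = P c2 c1 c1 - P c3 c1 c1
    q = η * η - (P c1 c1 c1 - P c3 c1 c1) * η - (k₁ - P c3 c1 c1)

    v+A₁v+A₂v+A₃v≈0 : ∀ u → v u + (η * v u + (y u + (z u + 0#))) ≈ 0#
    v+A₁v+A₂v+A₃v≈0 u = begin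
      v u + (η * v u + (y u + (z u + 0#)))   ≈⟨ +-cong (adj-zero-· X v u) (+-congʳ (eigen u)) ⟨
      sum (λ t → (adj X t · v) u)            ≈⟨ sum-adj-· X v u ⟩
      ⟨ v , 𝟙 ⟩                              ≈⟨ v⊥𝟙 ⟩
      0#                                     ∎

    A₁A₁v≈ : ∀ u → η * (η * v u) ≈ k₁ * v u + (P c1 c1 c1 * (η * v u) + (P c2 c1 c1 * y u + (P c3 c1 c1 * z u + 0#)))
    A₁A₁v≈ u = begin
      η * (η * v u)                          ≈⟨ *-congˡ (eigen u) ⟨
      η * (adj X c1 · v) u                   ≈⟨ ·-scalar (adj X c1) η v u ⟨
      (adj X c1 · (λ x → η * v x)) u         ≈⟨ ·-congʳ (adj X c1) eigen u ⟨
      (adj X c1 · (adj X c1 · v)) u          ≈⟨ adj-·-adj X c1 c1 v u ⟩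
      sum (λ t → P t c1 c1 * (adj X t · v) u)
        ≈⟨ +-cong (*-congˡ (adj-zero-· X v u)) (+-congʳ (*-congˡ (eigen u))) ⟩
      k₁ * v u + (P c1 c1 c1 * (η * v u) + (P c2 c1 c1 * y u + (P c3 c1 c1 * z u + 0#))) ∎

    A₁A₂v≈ : ∀ u → (adj X c1 · y) u ≈ P c1 c1 c2 * (η * v u) + (P c2 c1 c2 * y u + (P c3 c1 c2 * z u + 0#))
    A₁A₂v≈ u = begin
      (adj X c1 · y) u                           ≈⟨ adj-·-adj X c1 c2 v u ⟩
      P c0 c1 c2 * (adj X c0 · v) u + rest       ≡⟨ cong (λ m → ι m * (adj X c0 · v) u + rest) (p-zero-≢ X u λ ()) ⟩
      0# * (adj X c0 · v) u + rest               ≈⟨ trans (+-congʳ (zeroˡ _)) (+-identityˡ rest) ⟩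
      rest                                       ≈⟨ +-congʳ (*-congˡ (eigen u)) ⟩
      P c1 c1 c2 * (η * v u) + (P c2 c1 c2 * y u + (P c3 c1 c2 * z u + 0#)) ∎
      where
      rest = P c1 c1 c2 * (adj X c1 · v) u + (P c2 c1 c2 * y u + (P c3 c1 c2 * z u + 0#))

    αy≈qv : ∀ u → α * y u ≈ q * v u
    αy≈qv u = quadratic-relation (A₁A₁v≈ u) (v+A₁v+A₂v+A₃v≈0 u)

    αA₁y≈qηv : ∀ u → α * (adj X c1 · y) u ≈ q * (η * v u)
    αA₁y≈qηv u = begin
      α * (adj X c1 · y) u                ≈⟨ ·-scalar (adj X c1) α y u ⟨
      (adj X c1 · (λ x → α * y x)) u      ≈⟨ ·-congʳ (adj X c1) αy≈qv u ⟩
      (adj X c1 · (λ x → q * v x)) u      ≈⟨ ·-scalar (adj X c1) q v u ⟩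
      q * (adj X c1 · v) u                ≈⟨ *-congˡ (eigen u) ⟩
      q * (η * v u)                       ∎

    cubic·v≈0 : ∀ u → (η * η * η + a₁ * η * η + a₂ * η + a₃) * v u ≈ 0#
    cubic·v≈0 u = cubic-relation (αy≈qv u) (αA₁y≈qηv u) (A₁A₂v≈ u) (v+A₁v+A₂v+A₃v≈0 u)

lemma3p1 : ∀ {c ℓ} (K : Field c ℓ) {n : ℕ} (X : AssociationScheme n 4) (η : Field.Carrier K) →
    FieldOps.NontrivialEigenvalue K X (FieldOps.c1 K) η →
    Field._≈_ K
      (Field._+_ K (Field._+_ K (Field._+_ K
        (Field._*_ K (Field._*_ K η η) η)
        (Field._*_ K (Field._*_ K (FieldOps.Coeffs.a₁ K X) η) η))
        (Field._*_ K (FieldOps.Coeffs.a₂ K X) η))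
        (FieldOps.Coeffs.a₃ K X))
      (Field.0# K)
lemma3p1 K X η (v , (u , v[u]≉0) , v⊥𝟙 , eigen) =
  x*y≈0⇒y≉0⇒x≈0 K (RankFour.cubic·v≈0 K X v eigen v⊥𝟙 u) v[u]≉0
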